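{- Let $P$ be the set of elements placed by RoughScatter (described in the context) and let $x\in P$ be an arbitrary placed item. Then $x$ is assigned to bucket $B_i$ with probability $1/k$, for every $i\in\{1,\dots,k\}$.
   Context: An array $X[1..n]$ is split into $k$ contiguous buckets of (up to rounding) equal size $n/k$. Bucket $B_i$ is a triple of indices $(b_i,s_i,e_i)$: positions $[b_i,s_i)$ hold "placed" items and $[s_i,e_i)$ hold "staged" items; initially $s_i=b_i$. A bucket is full iff $s_i=e_i$. RoughScatter repeats: draw $j$ uniformly at random from $\{1,\dots,k\}$ independently of everything else, swap $X[s_1]$ with $X[s_j]$ (skipped if $j=1$), and increment $s_j$ (the element originally at $X[s_1]$ is thereby placed, i.e. assigned, to bucket $B_j$); it stops as soon as some bucket is full. -}

module Defs where

open import Data.Nat using (ℕ; zero; suc; _+_; _*_; _≡ᵇ_; NonZero)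
open import Data.Nat.DivMod using (_/_)
open import Data.Fin using (Fin; toℕ) renaming (zero to fzero; _≟_ to _≟ᶠ_)
open import Data.Bool using (Bool; true; false; if_then_else_)
open import Data.Maybe using (Maybe; just; nothing; is-just)
open import Data.List using (List; []; _∷_; foldl; map; concatMap; allFin; length; filter)
open import Data.Bool.ListAction using (any)
open import Data.Vec using (Vec; toList) renaming ([] to []ᵥ; _∷_ to _∷ᵥ_)
open import Relation.Nullary using (does)
open import Relation.Binary.PropositionalEquality using (_≡_)

-- Conventions: positions of X are 0-indexed 0..n-1; buckets are indexed by
-- Fin k, bucket fzero playing the role of B_1.  Bucket j occupies
-- [ ⌊j n / k⌋ , ⌊(j+1) n / k⌋ ).  Items are identified by their ORIGINAL
-- position in X (X is initially the identity permutation of positions).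

fin0 : (k : ℕ) → .{{NonZero k}} → Fin k
fin0 (suc k) = fzero

module _ (n k : ℕ) .{{nz : NonZero k}} where

  bBeg : Fin k → ℕ
  bBeg j = (toℕ j * n) / k

  bEnd : Fin k → ℕ
  bEnd j = (suc (toℕ j) * n) / k

  record State : Set where
    constructor st
    field
      s   : Fin k → ℕ
      arr : ℕ → ℕ                   -- arr q = original id of the item at position q
      asg : ℕ → Maybe (Fin k)       -- item id ↦ bucket it was placed into (if placed)

  open State

  initState : State
  initState = st bBeg (λ q → q) (λ _ → nothing)

  someFull : State → Bool
  someFull σ = any (λ j → s σ j ≡ᵇ bEnd j) (allFin k)

  step : State → Fin k → State
  step σ j with someFull σ
  ... | true  = σ
  ... | false =
    let a  = s σ (fin0 k)
        b  = s σ j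
        x  = arr σ a
        y  = arr σ b
    in st (λ i → if does (i ≟ᶠ j) then suc (s σ i) else s σ i)
          (λ q → if q ≡ᵇ a then y else (if q ≡ᵇ b then x else arr σ q))
          (λ z → if z ≡ᵇ x then just j else asg σ z)

  -- RoughScatter runs at most n iterations (each places one of n items), so
  -- running it on n independent uniform draws gives the full process.
  run : Vec (Fin k) n → State
  run ds = foldl step initState (toList ds)

  assignment : Vec (Fin k) n → ℕ → Maybe (Fin k)
  assignment ds p = asg (run ds) p

allVecs : (k m : ℕ) → List (Vec (Fin k) m)
allVecs k zero    = []ᵥ ∷ []
allVecs k (suc m) = concatMap (λ v → map (λ j → j ∷ᵥ v) (allFin k)) (allVecs k m)

count : {k m : ℕ} → (Vec (Fin k) m → Bool) → ℕ
count {k} {m} E = length (filter (λ v → Data.Bool._≟_ (E v) true) (allVecs k m))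
  where import Data.Bool

Placed : (n k : ℕ) .{{_ : NonZero k}} → ℕ → Vec (Fin k) n → Bool
Placed n k p ds = is-just (assignment n k ds p)

PlacedIn : (n k : ℕ) .{{_ : NonZero k}} → ℕ → Fin k → Vec (Fin k) n → Bool
PlacedIn n k p i ds with assignment n k ds p
... | nothing = false
... | just j  = does (j ≟ᶠ i)

-- Whether the item x is placed in an iteration of RoughScatter, and if so when,
-- is decided before that iteration's draw j: x is placed exactly when it sits at
-- position s₁ and no bucket is full.  The draw then only chooses the bucket, and
-- once placed x never moves again, because staged positions always hold unplaced
-- items.  Summing over the first draw, every state in which x is still unplaced
-- therefore contributes to each bucket equally.
module Submission where

open import Data.Bool using (Bool; true; false; T; if_then_else_)
import Data.Bool as Bool
open import Data.Bool.Properties using (if-float)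
open import Data.Fin using (Fin; toℕ) renaming (zero to fzero; suc to fsuc)
import Data.Fin.Properties as Fin
open import Data.Fin.Properties using () renaming (_≟_ to _≟ᶠ_)
open import Data.List using (List; []; _∷_; _++_; map; concatMap; allFin; length; filter; foldl)
open import Data.List.Membership.Propositional using (lose)
open import Data.List.Membership.Propositional.Properties using (∈-allFin)
open import Data.List.Properties using (map-cong; map-∘; map-tabulate; map-++; length-tabulate)
open import Data.List.Relation.Unary.Any.Properties using (any⁺)
open import Data.Maybe using (Maybe; just; nothing; is-just)
open import Data.Nat using (ℕ; zero; suc; _+_; _*_; _≤_; _<_; _≡ᵇ_; _≟_; NonZero)
open import Data.Nat.DivMod using (/-monoˡ-≤)
open import Data.Nat.ListAction using (sum)
open import Data.Nat.ListAction.Properties using (sum-++)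
open import Data.Nat.Properties
open import Algebra.Properties.CommutativeSemigroup +-commutativeSemigroup using (interchange)
open import Data.Sum using (_⊎_; inj₁; inj₂)
open import Data.Vec using (Vec; toList) renaming (_∷_ to _∷ᵥ_)
open import Function using (_∘_; id)
open import Function.Definitions using (Injective)
open import Relation.Binary.Definitions using (tri<; tri≈; tri>)
open import Relation.Binary.PropositionalEquality
open import Relation.Nullary using (does; yes; no; contradiction)
open import Relation.Nullary.Decidable using (dec-true; dec-false)

open import Defs

𝟙 : Bool → ℕ
𝟙 true  = 1
𝟙 false = 0

length-filter≡sum-𝟙 : ∀ {A : Set} (P : A → Bool) (xs : List A) →
  length (filter (λ a → P a Bool.≟ true) xs) ≡ sum (map (𝟙 ∘ P) xs)
length-filter≡sum-𝟙 P [] = refl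
length-filter≡sum-𝟙 P (a ∷ xs) with P a
... | true  = cong suc (length-filter≡sum-𝟙 P xs)
... | false = length-filter≡sum-𝟙 P xs

sum-map-const : ∀ {A : Set} c (xs : List A) → sum (map (λ _ → c) xs) ≡ length xs * c
sum-map-const c []       = refl
sum-map-const c (_ ∷ xs) = cong (c +_) (sum-map-const c xs)

*-distribˡ-sum-map : ∀ {A : Set} c (f : A → ℕ) (xs : List A) →
  c * sum (map f xs) ≡ sum (map (λ a → c * f a) xs)
*-distribˡ-sum-map c f []       = *-zeroʳ c
*-distribˡ-sum-map c f (a ∷ xs) =
  trans (*-distribˡ-+ c (f a) _) (cong (c * f a +_) (*-distribˡ-sum-map c f xs))

sum-map-+ : ∀ {A : Set} (f g : A → ℕ) (xs : List A) →
  sum (map (λ a → f a + g a) xs) ≡ sum (map f xs) + sum (map g xs)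
sum-map-+ f g []       = refl
sum-map-+ f g (a ∷ xs) =
  trans (cong (f a + g a +_) (sum-map-+ f g xs)) (interchange (f a) (g a) _ _)

sum-map-sum-comm : ∀ {A B : Set} (F : A → B → ℕ) (xs : List A) (ys : List B) →
  sum (map (λ a → sum (map (F a) ys)) xs) ≡ sum (map (λ b → sum (map (λ a → F a b) xs)) ys)
sum-map-sum-comm F []       ys = sym (trans (sum-map-const 0 ys) (*-zeroʳ (length ys)))
sum-map-sum-comm F (a ∷ xs) ys =
  trans (cong (sum (map (F a) ys) +_) (sum-map-sum-comm F xs ys))
        (sym (sum-map-+ (F a) (λ b → sum (map (λ a → F a b) xs)) ys))

sum-map-concatMap : ∀ {A B : Set} (f : B → ℕ) (g : A → List B) (xs : List A) →
  sum (map f (concatMap g xs)) ≡ sum (map (λ a → sum (map f (g a))) xs)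
sum-map-concatMap f g []       = refl
sum-map-concatMap f g (a ∷ xs) = begin
  sum (map f (g a ++ concatMap g xs))                         ≡⟨ cong sum (map-++ f (g a) _) ⟩
  sum (map f (g a) ++ map f (concatMap g xs))                 ≡⟨ sum-++ (map f (g a)) _ ⟩
  sum (map f (g a)) + sum (map f (concatMap g xs))            ≡⟨ cong (sum (map f (g a)) +_) (sum-map-concatMap f g xs) ⟩
  sum (map f (g a)) + sum (map (λ a → sum (map f (g a))) xs)  ∎
  where open ≡-Reasoning

sum-map-allFin-suc : ∀ {k} (g : Fin (suc k) → ℕ) →
  sum (map g (allFin (suc k))) ≡ g fzero + sum (map (g ∘ fsuc) (allFin k))
sum-map-allFin-suc {k} g =
  cong (λ ys → g fzero + sum ys) (trans (map-tabulate fsuc g) (sym (map-tabulate id (g ∘ fsuc))))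

sum-𝟙-≟-allFin : ∀ {k} (i : Fin k) → sum (map (λ j → 𝟙 (does (j ≟ᶠ i))) (allFin k)) ≡ 1
sum-𝟙-≟-allFin {suc k} fzero = begin
  sum (map (λ j → 𝟙 (does (j ≟ᶠ fzero))) (allFin (suc k)))  ≡⟨ sum-map-allFin-suc {k} (λ j → 𝟙 (does (j ≟ᶠ fzero))) ⟩
  1 + sum (map (λ _ → 0) (allFin k))                        ≡⟨ cong suc (sum-map-const 0 (allFin k)) ⟩
  1 + length (allFin k) * 0                                 ≡⟨ cong suc (*-zeroʳ (length (allFin k))) ⟩
  1 ∎
  where open ≡-Reasoning
sum-𝟙-≟-allFin {suc k} (fsuc i) =
  trans (sum-map-allFin-suc (λ j → 𝟙 (does (j ≟ᶠ fsuc i)))) (sum-𝟙-≟-allFin i)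

sum-map-allVecs-suc : ∀ {k m} (g : Vec (Fin k) (suc m) → ℕ) →
  sum (map g (allVecs k (suc m))) ≡ sum (map (λ j → sum (map (g ∘ (j ∷ᵥ_)) (allVecs k m))) (allFin k))
sum-map-allVecs-suc {k} {m} g = begin
  sum (map g (allVecs k (suc m)))
    ≡⟨ sum-map-concatMap g (λ ds → map (_∷ᵥ ds) (allFin k)) (allVecs k m) ⟩
  sum (map (λ ds → sum (map g (map (_∷ᵥ ds) (allFin k)))) (allVecs k m))
    ≡⟨ cong sum (map-cong (λ ds → cong sum (sym (map-∘ (allFin k)))) (allVecs k m)) ⟩
  sum (map (λ ds → sum (map (λ j → g (j ∷ᵥ ds)) (allFin k))) (allVecs k m))
    ≡⟨ sum-map-sum-comm (λ ds j → g (j ∷ᵥ ds)) (allVecs k m) (allFin k) ⟩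
  sum (map (λ j → sum (map (g ∘ (j ∷ᵥ_)) (allVecs k m))) (allFin k)) ∎
  where open ≡-Reasoning

inBucket : ∀ {k} → Fin k → Maybe (Fin k) → Bool
inBucket i nothing  = false
inBucket i (just j) = does (j ≟ᶠ i)

module UniformPlacement
  {S : Set} {k : ℕ} (step : S → Fin k → S) (bucketOf : S → Maybe (Fin k))
  (Inv : S → Set) (Inv-step : ∀ {σ} → Inv σ → ∀ j → Inv (step σ j))
  (placement-persists : ∀ {σ c} → Inv σ → bucketOf σ ≡ just c → ∀ j → bucketOf (step σ j) ≡ just c)
  (placement-by-draw : ∀ {σ} → Inv σ → bucketOf σ ≡ nothing →
     (∀ j → bucketOf (step σ j) ≡ nothing) ⊎ (∀ j → bucketOf (step σ j) ≡ just j))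
  where

  tally : ℕ → (Maybe (Fin k) → ℕ) → S → ℕ
  tally m f σ = sum (map (λ ds → f (bucketOf (foldl step σ (toList ds)))) (allVecs k m))

  tally-suc : ∀ m f σ → tally (suc m) f σ ≡ sum (map (λ j → tally m f (step σ j)) (allFin k))
  tally-suc m f σ = sum-map-allVecs-suc {k} {m} (λ ds → f (bucketOf (foldl step σ (toList ds))))

  tally-placed : ∀ m f {σ c} → Inv σ → bucketOf σ ≡ just c → tally m f σ ≡ length (allVecs k m) * f (just c)
  tally-placed m f {σ} {c} inv placed =
    trans (cong sum (map-cong (λ ds → cong f (persists* (toList ds) inv placed)) (allVecs k m)))
          (sum-map-const (f (just c)) (allVecs k m))
    where
    persists* : ∀ js {τ} → Inv τ → bucketOf τ ≡ just c → bucketOf (foldl step τ js) ≡ just c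
    persists* []       inv placed = placed
    persists* (j ∷ js) inv placed = persists* js (Inv-step inv j) (placement-persists inv placed j)

  uniform-placement : ∀ m i {σ} → Inv σ → bucketOf σ ≡ nothing →
    k * tally m (𝟙 ∘ inBucket i) σ ≡ tally m (𝟙 ∘ is-just) σ
  uniform-placement zero    i inv unplaced rewrite unplaced = *-zeroʳ k
  uniform-placement (suc m) i {σ} inv unplaced
    rewrite tally-suc m (𝟙 ∘ inBucket i) σ | tally-suc m (𝟙 ∘ is-just) σ
    with placement-by-draw inv unplaced
  ... | inj₁ stays = trans (*-distribˡ-sum-map k (λ j → tally m (𝟙 ∘ inBucket i) (step σ j)) (allFin k))
          (cong sum (map-cong (λ j → uniform-placement m i (Inv-step inv j) (stays j)) (allFin k)))
  ... | inj₂ lands = begin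
    k * sum (map (λ j → tally m (𝟙 ∘ inBucket i) (step σ j)) (allFin k))
      ≡⟨ cong (λ t → k * sum t) (map-cong (λ j → tally-placed m (𝟙 ∘ inBucket i) (Inv-step inv j) (lands j)) (allFin k)) ⟩
    k * sum (map (λ j → L * 𝟙 (does (j ≟ᶠ i))) (allFin k))
      ≡⟨ cong (k *_) (sym (*-distribˡ-sum-map L (λ j → 𝟙 (does (j ≟ᶠ i))) (allFin k))) ⟩
    k * (L * sum (map (λ j → 𝟙 (does (j ≟ᶠ i))) (allFin k)))
      ≡⟨ cong (λ t → k * (L * t)) (sum-𝟙-≟-allFin i) ⟩
    k * (L * 1)
      ≡⟨ cong (_* (L * 1)) (sym (length-tabulate {n = k} id)) ⟩
    length (allFin k) * (L * 1)
      ≡⟨ sym (sum-map-const (L * 1) (allFin k)) ⟩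
    sum (map (λ _ → L * 1) (allFin k))
      ≡⟨ cong sum (map-cong (λ j → sym (tally-placed m (𝟙 ∘ is-just) (Inv-step inv j) (lands j))) (allFin k)) ⟩
    sum (map (λ j → tally m (𝟙 ∘ is-just) (step σ j)) (allFin k)) ∎
    where
    open ≡-Reasoning
    L : ℕ
    L = length (allVecs k m)

≡ᵇ-true : ∀ {m n} → m ≡ n → (m ≡ᵇ n) ≡ true
≡ᵇ-true {m} {n} = dec-true (m ≟ n)

≡ᵇ-false : ∀ {m n} → m ≢ n → (m ≡ᵇ n) ≡ false
≡ᵇ-false {m} {n} = dec-false (m ≟ n)

swapped : (ℕ → ℕ) → ℕ → ℕ → ℕ → ℕ
swapped f a b q = if q ≡ᵇ a then f b else if q ≡ᵇ b then f a else f q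

module _ (f : ℕ → ℕ) (a b : ℕ) where

  swapped-a : swapped f a b a ≡ f b
  swapped-a rewrite ≡ᵇ-true (refl {x = a}) = refl

  swapped-b : swapped f a b b ≡ f a
  swapped-b with b ≟ a
  ... | yes refl = swapped-a
  ... | no b≢a rewrite ≡ᵇ-false b≢a | ≡ᵇ-true (refl {x = b}) = refl

  swapped-other : ∀ {q} → q ≢ a → q ≢ b → swapped f a b q ≡ f q
  swapped-other q≢a q≢b rewrite ≡ᵇ-false q≢a | ≡ᵇ-false q≢b = refl

  swapped-∘ : ∀ q → swapped f a b q ≡ f (swapped id a b q)
  swapped-∘ q = sym (trans (if-float f (q ≡ᵇ a)) (cong (if q ≡ᵇ a then f b else_) (if-float f (q ≡ᵇ b))))

swapped-involutive : ∀ a b q → swapped id a b (swapped id a b q) ≡ q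
swapped-involutive a b q with q ≟ a | q ≟ b
... | yes refl | _        = trans (cong (swapped id q b) (swapped-a id q b)) (swapped-b id q b)
... | no _     | yes refl = trans (cong (swapped id a q) (swapped-b id a q)) (swapped-a id a q)
... | no q≢a   | no q≢b   =
  trans (cong (swapped id a b) (swapped-other id a b q≢a q≢b)) (swapped-other id a b q≢a q≢b)

swapped-injective : ∀ {f} a b → Injective _≡_ _≡_ f → Injective _≡_ _≡_ (swapped f a b)
swapped-injective {f} a b f-inj {p} {q} eq = begin
  p                                       ≡⟨ sym (swapped-involutive a b p) ⟩
  swapped id a b (swapped id a b p)       ≡⟨ cong (swapped id a b) τp≡τq ⟩
  swapped id a b (swapped id a b q)       ≡⟨ swapped-involutive a b q ⟩
  q ∎
  where
  open ≡-Reasoning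
  τp≡τq : swapped id a b p ≡ swapped id a b q
  τp≡τq = f-inj (trans (sym (swapped-∘ f a b p)) (trans eq (swapped-∘ f a b q)))

module RoughScatter (n k : ℕ) .{{_ : NonZero k}} where
  open State

  bBeg≤bEnd : ∀ i → bBeg n k i ≤ bEnd n k i
  bBeg≤bEnd i = /-monoˡ-≤ k (*-monoˡ-≤ n (n≤1+n (toℕ i)))

  bEnd≤bBeg : ∀ {i j : Fin k} → toℕ i < toℕ j → bEnd n k i ≤ bBeg n k j
  bEnd≤bBeg i<j = /-monoˡ-≤ k (*-monoˡ-≤ n i<j)

  buckets-disjoint : ∀ {i j q} → bBeg n k i ≤ q → q < bEnd n k i → bBeg n k j ≤ q → q < bEnd n k j → i ≡ j
  buckets-disjoint {i} {j} bi≤q q<ei bj≤q q<ej with Fin.<-cmp i j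
  ... | tri< i<j _ _ = contradiction (≤-trans (bEnd≤bBeg i<j) bj≤q) (<⇒≱ q<ei)
  ... | tri≈ _ i≡j _ = i≡j
  ... | tri> _ _ j<i = contradiction (≤-trans (bEnd≤bBeg j<i) bi≤q) (<⇒≱ q<ej)

  record Invariant (σ : State n k) : Set where
    field
      arr-injective   : Injective _≡_ _≡_ (arr σ)
      bBeg≤s          : ∀ i → bBeg n k i ≤ s σ i
      s≤bEnd          : ∀ i → s σ i ≤ bEnd n k i
      staged-unplaced : ∀ i {q} → s σ i ≤ q → q < bEnd n k i → asg σ (arr σ q) ≡ nothing
  open Invariant

  Invariant-init : Invariant (initState n k)
  Invariant-init = record
    { arr-injective   = id
    ; bBeg≤s          = λ _ → ≤-refl
    ; s≤bEnd          = bBeg≤bEnd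
    ; staged-unplaced = λ _ _ _ → refl
    }

  not-full⇒s<bEnd : ∀ {σ} → Invariant σ → someFull n k σ ≡ false → ∀ i → s σ i < bEnd n k i
  not-full⇒s<bEnd {σ} inv notFull i = ≤∧≢⇒< (s≤bEnd inv i) λ full-i →
    subst T notFull (any⁺ _ (lose (∈-allFin i) (≡⇒≡ᵇ (s σ i) (bEnd n k i) full-i)))

  bump : (Fin k → ℕ) → Fin k → Fin k → ℕ
  bump t j i = if does (i ≟ᶠ j) then suc (t i) else t i

  assign : (ℕ → Maybe (Fin k)) → ℕ → Fin k → ℕ → Maybe (Fin k)
  assign g x j z = if z ≡ᵇ x then just j else g z

  place : State n k → Fin k → State n k
  place σ j = st (bump (s σ) j) (swapped (arr σ) a b) (assign (asg σ) (arr σ a) j)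
    where
    a b : ℕ
    a = s σ (fin0 k)
    b = s σ j

  step-halted : ∀ {σ} j → someFull n k σ ≡ true → step n k σ j ≡ σ
  step-halted j full rewrite full = refl

  step-active : ∀ {σ} j → someFull n k σ ≡ false → step n k σ j ≡ place σ j
  step-active j notFull rewrite notFull = refl

  assign-≡ : ∀ g {x} j {z} → z ≡ x → assign g x j z ≡ just j
  assign-≡ g j z≡x rewrite ≡ᵇ-true z≡x = refl

  assign-≢ : ∀ g {x} j {z} → z ≢ x → assign g x j z ≡ g z
  assign-≢ g j z≢x rewrite ≡ᵇ-false z≢x = refl

  step-elim : ∀ (P : State n k → Set) {σ} j →
    P σ → (someFull n k σ ≡ false → P (place σ j)) → P (step n k σ j)
  step-elim P {σ} j halted active = by-fullness (someFull n k σ) refl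
    where
    by-fullness : ∀ full? → someFull n k σ ≡ full? → P (step n k σ j)
    by-fullness true  full    = subst P (sym (step-halted j full)) halted
    by-fullness false notFull = subst P (sym (step-active j notFull)) (active notFull)

  module _ {σ : State n k} (inv : Invariant σ) (notFull : someFull n k σ ≡ false) (j : Fin k) where
    private
      a b : ℕ
      a = s σ (fin0 k)
      b = s σ j

      s<bEnd : ∀ i → s σ i < bEnd n k i
      s<bEnd = not-full⇒s<bEnd inv notFull

    s≤bump : ∀ i → s σ i ≤ bump (s σ) j i
    s≤bump i with i ≟ᶠ j
    ... | yes _ = n≤1+n (s σ i)
    ... | no _  = ≤-refl

    bump≤bEnd : ∀ i → bump (s σ) j i ≤ bEnd n k i
    bump≤bEnd i with i ≟ᶠ j
    ... | yes refl = s<bEnd i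
    ... | no _     = s≤bEnd inv i

    staged-after-bump⇒≢b : ∀ i {q} → bump (s σ) j i ≤ q → q < bEnd n k i → q ≢ b
    staged-after-bump⇒≢b i bump≤q q<e refl with i ≟ᶠ j
    ... | yes refl = <-irrefl refl bump≤q
    ... | no i≢j   = i≢j (buckets-disjoint (≤-trans (bBeg≤s inv i) bump≤q) q<e (bBeg≤s inv j) (s<bEnd j))

    place-staged-unplaced : ∀ i {q} → bump (s σ) j i ≤ q → q < bEnd n k i →
      assign (asg σ) (arr σ a) j (swapped (arr σ) a b q) ≡ nothing
    place-staged-unplaced i {q} bump≤q q<e with q ≟ a | staged-after-bump⇒≢b i bump≤q q<e
    ... | yes refl | q≢b = begin
      assign (asg σ) (arr σ a) j (swapped (arr σ) a b a) ≡⟨ cong (assign (asg σ) (arr σ a) j) (swapped-a (arr σ) a b) ⟩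
      assign (asg σ) (arr σ a) j (arr σ b)               ≡⟨ assign-≢ (asg σ) j (q≢b ∘ sym ∘ arr-injective inv) ⟩
      asg σ (arr σ b)                                    ≡⟨ staged-unplaced inv j ≤-refl (s<bEnd j) ⟩
      nothing                                            ∎
      where open ≡-Reasoning
    ... | no q≢a   | q≢b = begin
      assign (asg σ) (arr σ a) j (swapped (arr σ) a b q) ≡⟨ cong (assign (asg σ) (arr σ a) j) (swapped-other (arr σ) a b q≢a q≢b) ⟩
      assign (asg σ) (arr σ a) j (arr σ q)               ≡⟨ assign-≢ (asg σ) j (q≢a ∘ arr-injective inv) ⟩
      asg σ (arr σ q)                                    ≡⟨ staged-unplaced inv i (≤-trans (s≤bump i) bump≤q) q<e ⟩
      nothing                                            ∎
      where open ≡-Reasoning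

    Invariant-place : Invariant (place σ j)
    Invariant-place = record
      { arr-injective   = swapped-injective a b (arr-injective inv)
      ; bBeg≤s          = λ i → ≤-trans (bBeg≤s inv i) (s≤bump i)
      ; s≤bEnd          = bump≤bEnd
      ; staged-unplaced = place-staged-unplaced
      }

  Invariant-step : ∀ {σ} → Invariant σ → ∀ j → Invariant (step n k σ j)
  Invariant-step inv j = step-elim Invariant j inv (λ notFull → Invariant-place inv notFull j)

  module _ (x : ℕ) where

    placement-persists : ∀ {σ c} → Invariant σ → asg σ x ≡ just c → ∀ j → asg (step n k σ j) x ≡ just c
    placement-persists {σ} {c} inv placed j =
      step-elim (λ τ → asg τ x ≡ just c) j placed λ notFull → trans (assign-≢ (asg σ) j (x≢x₀ notFull)) placed
      where
      x≢x₀ : someFull n k σ ≡ false → x ≢ arr σ (s σ (fin0 k))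
      x≢x₀ notFull x≡x₀ with () ← trans (sym placed) (trans (cong (asg σ) x≡x₀)
        (staged-unplaced inv (fin0 k) ≤-refl (not-full⇒s<bEnd inv notFull (fin0 k))))

    placement-by-draw : ∀ {σ} → Invariant σ → asg σ x ≡ nothing →
      (∀ j → asg (step n k σ j) x ≡ nothing) ⊎ (∀ j → asg (step n k σ j) x ≡ just j)
    placement-by-draw {σ} inv unplaced = by-fullness (someFull n k σ) refl
      where
      by-fullness : ∀ full? → someFull n k σ ≡ full? →
        (∀ j → asg (step n k σ j) x ≡ nothing) ⊎ (∀ j → asg (step n k σ j) x ≡ just j)
      by-fullness true full = inj₁ λ j → trans (cong (λ τ → asg τ x) (step-halted j full)) unplaced
      by-fullness false notFull with x ≟ arr σ (s σ (fin0 k))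
      ... | yes x≡x₀ = inj₂ λ j → trans (cong (λ τ → asg τ x) (step-active j notFull)) (assign-≡ (asg σ) j x≡x₀)
      ... | no x≢x₀  = inj₁ λ j →
        trans (cong (λ τ → asg τ x) (step-active j notFull)) (trans (assign-≢ (asg σ) j x≢x₀) unplaced)

    open UniformPlacement (step n k) (λ σ → asg σ x) Invariant Invariant-step placement-persists placement-by-draw public

    PlacedIn≡inBucket : ∀ i ds → PlacedIn n k x i ds ≡ inBucket i (assignment n k ds x)
    PlacedIn≡inBucket i ds with assignment n k ds x
    ... | nothing = refl
    ... | just _  = refl

lemma1 : (n k : ℕ) .{{_ : NonZero k}} → (x : ℕ) → x < n → (i : Fin k) →
           k * count (PlacedIn n k x i) ≡ count (Placed n k x)
lemma1 n k x _ i = begin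
  k * count (PlacedIn n k x i)
    ≡⟨ cong (k *_) (length-filter≡sum-𝟙 (PlacedIn n k x i) (allVecs k n)) ⟩
  k * sum (map (𝟙 ∘ PlacedIn n k x i) (allVecs k n))
    ≡⟨ cong (λ t → k * sum t) (map-cong (cong 𝟙 ∘ PlacedIn≡inBucket x i) (allVecs k n)) ⟩
  k * tally x n (𝟙 ∘ inBucket i) (initState n k)
    ≡⟨ uniform-placement x n i Invariant-init refl ⟩
  tally x n (𝟙 ∘ is-just) (initState n k)
    ≡⟨ sym (length-filter≡sum-𝟙 (Placed n k x) (allVecs k n)) ⟩
  count (Placed n k x) ∎
  where
  open ≡-Reasoning
  open RoughScatter n k
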